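{- Let $k\geq 1$ and let $W\in C_k$ be a canonical word. Then $W$ is a shuffle square if and only if $W$ has no subword of the form $\mathtt{XYYX}$, where $\mathtt{X}$ and $\mathtt{Y}$ are single letters. Moreover, the number of shuffle squares in $C_k$ equals the Catalan number $\frac{1}{k+1}\binom{2k}{k}$.
   Context: Let $\mathbb{A}=\{\mathtt{A}_1,\dots,\mathtt{A}_k\}$ with the order $\mathtt{A}_1<\cdots<\mathtt{A}_k$. Consider words of length $2k$ over $\mathbb{A}$ in which every letter occurs exactly twice; identify two such words if one is obtained from the other by a permutation of the alphabet, and from each class pick the lexicographically least word. These representatives form the set $C_k$ of \emph{canonical words} (equivalently, words in which each letter occurs exactly twice and the first occurrences of the letters appear in the order $\mathtt{A}_1,\mathtt{A}_2,\dots,\mathtt{A}_k$); $|C_k|=\frac{(2k)!}{k!\,2^k}$. A \emph{subword} of $W$ is a word obtained by deleting some (possibly zero) letters of $W$ (not necessarily consecutive). A \emph{shuffle square} is a word whose positions can be partitioned into two sets so that the two resulting subwords are identical. -}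

module Defs where

open import Data.Nat using (ℕ; suc; _/_)
open import Data.Nat.Combinatorics using (_C_)
open import Data.Nat as ℕ using (_*_)
open import Data.Bool using (Bool; true; false; not)
open import Data.Fin using (Fin; _≟_)
open import Data.List using (List; []; _∷_; length; filter; map; deduplicate; allFin)
open import Data.List.Relation.Binary.Sublist.Propositional using (_⊆_)
open import Data.Product using (Σ; ∃; _×_; ∃-syntax)
open import Relation.Binary.PropositionalEquality using (_≡_)

-- Words over the alphabet A_1 < ... < A_k, modelled as Fin k with its usual order.
Word : ℕ → Set
Word k = List (Fin k)

occ : ∀ {k} → Fin k → Word k → ℕ
occ a W = length (filter (_≟ a) W)

-- canonical word: every letter occurs exactly twice, and the first occurrences
-- of the letters appear in the order A_1, A_2, ..., A_k
-- (deduplicate keeps the first occurrence of each letter)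
Canonical : (k : ℕ) → Word k → Set
Canonical k W = (∀ (a : Fin k) → occ a W ≡ 2) × (deduplicate _≟_ W ≡ allFin k)

select : ∀ {A : Set} → List Bool → List A → List A
select []          _        = []
select (_ ∷ _)     []       = []
select (true ∷ m)  (x ∷ xs) = x ∷ select m xs
select (false ∷ m) (x ∷ xs) = select m xs

ShuffleSquare : ∀ {A : Set} → List A → Set
ShuffleSquare {A} W =
  Σ (List Bool) λ m → (length m ≡ length W) × (select m W ≡ select (map not m) W)

HasXYYX : ∀ {k} → Word k → Set
HasXYYX {k} W = ∃[ x ] ∃[ y ] ((x ∷ y ∷ y ∷ x ∷ []) ⊆ W)

catalan : ℕ → ℕ
catalan k = ((2 * k) C k) / suc k

{-# OPTIONS --safe #-}
module Submission where

open import Data.Bool using (Bool; true; false; not)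
open import Data.Empty using (⊥; ⊥-elim)
open import Data.Fin as Fin using (Fin; toℕ; fromℕ<; _≟_)
open import Data.Fin.Properties using (toℕ-fromℕ<; toℕ-injective; toℕ<n)
open import Data.List
  using (List; []; _∷_; [_]; _++_; length; filter; map; deduplicate; allFin; tabulate)
open import Data.List.Membership.Propositional using (_∈_)
open import Data.List.Membership.Propositional.Properties
  using (∈-map⁺; ∈-map⁻; ∈-++⁺ˡ; ∈-++⁺ʳ; ∈-++⁻)
open import Data.List.Properties
  using ( ++-assoc; ∷-injective; ∷-injectiveˡ; ∷-injectiveʳ; length-++; length-map
        ; filter-accept; filter-reject; filter-++; filter-≐; filter-all; tabulate-cong)
open import Data.List.Relation.Binary.Sublist.Propositional
  using (_⊆_; []; _∷_; _∷ʳ_; from∈; ⊆-trans)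
open import Data.List.Relation.Binary.Sublist.Propositional.Properties using (++⁺; ++⁺ʳ)
open import Data.List.Relation.Ternary.Interleaving.Propositional
  using (Interleaving; []; consˡ; consʳ; swap)
open import Data.List.Relation.Unary.All using (All)
import Data.List.Relation.Unary.All as All
open import Data.List.Relation.Unary.AllPairs using ([]; _∷_)
open import Data.List.Relation.Unary.Any using (here; there)
open import Data.List.Relation.Unary.Unique.Propositional using (Unique)
import Data.List.Relation.Unary.Unique.Propositional.Properties as Unique
open import Data.Nat as ℕ
  using (ℕ; zero; suc; _+_; _*_; _∸_; _/_; _≤_; _<_; _≥_; z≤n; s≤s; s≤s⁻¹; _<?_; _≤?_)
open import Data.Nat.Combinatorics using (_C_; nC1≡n; nCk≡nC[n∸k]; nCk+nC[k+1]≡[n+1]C[k+1])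
open import Data.Nat.Combinatorics.Specification using (k>n⇒nCk≡0)
open import Data.Nat.DivMod using (m*n/n≡m)
open import Data.Nat.Properties
  using ( ≤-refl; ≤-reflexive; ≤-trans; ≤-antisym; <-irrefl; <-trans; <-≤-trans; ≤-<-trans
        ; <⇒≤; <⇒≱; <⇒≢; ≮⇒≥; ≰⇒>; ≤∧≢⇒<; <-cmp; n≤1+n; m≤n⇒m≤1+n; m<n⇒m<1+n
        ; m≤m+n; m≤n+m; m<m+n; m+1+n≢m; m+1+n≢0; +-mono-≤-<; +-mono-<-≤; suc-injective
        ; +-suc; +-assoc; +-identityʳ; +-cancelʳ-≡; +-commutativeSemigroup
        ; *-comm; *-suc; *-zeroʳ; *-identityʳ; *-distribˡ-+; *-distribʳ-+
        ; +-∸-assoc; n∸n≡0; m+n∸m≡n)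
open import Algebra.Properties.CommutativeSemigroup +-commutativeSemigroup
  using (interchange; xy∙z≈xz∙y)
open import Data.Product using (Σ; ∃₂; _×_; _,_; proj₁; proj₂)
open import Data.Sum using (inj₁; inj₂)
open import Function.Base using (_∘_)
open import Function.Bundles using (_⇔_; mk⇔)
open import Level using (0ℓ)
open import Relation.Binary.Definitions using (tri<; tri≈; tri>)
open import Relation.Binary.PropositionalEquality
  using (_≡_; _≢_; refl; sym; trans; cong; cong₂; subst; subst₂; module ≡-Reasoning)
open import Relation.Nullary using (¬_; ¬?; Dec; yes; no; does; contradiction)
open import Relation.Unary using (Pred; Decidable)
open import Relation.Unary.Properties using (_∩?_)

open import Defs
-- A shuffle square W in which every letter occurs twice splits into two equal halves, each
-- containing every letter exactly once.  An occurrence of XYYX in W is shared between the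
-- halves; as neither half repeats a letter, one half reads XY and the other YX, which is
-- impossible.  Conversely, scan a canonical XYYX-free word from left to right: the first
-- occurrences come in alphabetical order, and so must the second ones, since closing a letter
-- while a smaller one is still open produces XYYX.  So W is the shuffle of A₁⋯A_k with itself
-- in which every letter is opened before it is closed, that is, a ballot path, and the
-- reflection principle counts these: (2k choose k) − (2k choose k−1) of them.

module _ {k : ℕ} {a : Fin k} where

  occ-here : ∀ {x} xs → x ≡ a → occ a (x ∷ xs) ≡ suc (occ a xs)
  occ-here xs x≡a = cong length (filter-accept (_≟ a) x≡a)

  occ-there : ∀ {x} xs → x ≢ a → occ a (x ∷ xs) ≡ occ a xs
  occ-there xs x≢a = cong length (filter-reject (_≟ a) x≢a)

  occ-++ : ∀ xs ys → occ a (xs ++ ys) ≡ occ a xs + occ a ys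
  occ-++ xs ys = trans (cong length (filter-++ (_≟ a) xs ys)) (length-++ (filter (_≟ a) xs))

  occ-mono : ∀ {xs ys} → xs ⊆ ys → occ a xs ≤ occ a ys
  occ-mono [] = z≤n
  occ-mono (y ∷ʳ xs⊆ys) with y ≟ a
  ... | yes _ = ≤-trans (occ-mono xs⊆ys) (n≤1+n _)
  ... | no _  = occ-mono xs⊆ys
  occ-mono (_∷_ {x = x} refl xs⊆ys) with x ≟ a
  ... | yes _ = s≤s (occ-mono xs⊆ys)
  ... | no _  = occ-mono xs⊆ys

  occ>0⇒∈ : ∀ {xs} → 0 < occ a xs → a ∈ xs
  occ>0⇒∈ {y ∷ xs} 0<occ with y ≟ a
  ... | yes refl = here refl
  ... | no _     = there (occ>0⇒∈ 0<occ)

  occ-select : ∀ (m : List Bool) (W : Word k) → length m ≡ length W →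
    occ a W ≡ occ a (select m W) + occ a (select (map not m) W)
  occ-select []          []      _   = refl
  occ-select (true ∷ m)  (x ∷ W) len with x ≟ a
  ... | yes _ = cong suc (occ-select m W (suc-injective len))
  ... | no _  = occ-select m W (suc-injective len)
  occ-select (false ∷ m) (x ∷ W) len with x ≟ a
  ... | yes _ = trans (cong suc (occ-select m W (suc-injective len))) (sym (+-suc _ _))
  ... | no _  = occ-select m W (suc-injective len)

  occ-twice : occ a (a ∷ a ∷ []) ≡ 2
  occ-twice = trans (occ-here _ refl) (cong suc (occ-here [] refl))

n+n≡2⇒n≡1 : ∀ n → n + n ≡ 2 → n ≡ 1
n+n≡2⇒n≡1 (suc zero)    _  = refl
n+n≡2⇒n≡1 (suc (suc n)) eq = contradiction (suc-injective (suc-injective eq)) (m+1+n≢0 n)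

m+n≡o+p∧n<p⇒o<m : ∀ {m n o p} → m + n ≡ o + p → n < p → o < m
m+n≡o+p∧n<p⇒o<m {m} {o = o} eq n<p with o <? m
... | yes o<m = o<m
... | no o≮m  = contradiction eq (<⇒≢ (+-mono-≤-< (≮⇒≥ o≮m) n<p))

m+n≡o+p∧o<m⇒n<p : ∀ {m n o p} → m + n ≡ o + p → o < m → n < p
m+n≡o+p∧o<m⇒n<p {n = n} {p = p} eq o<m with n <? p
... | yes n<p = n<p
... | no n≮p  = contradiction (sym eq) (<⇒≢ (+-mono-<-≤ o<m (≮⇒≥ n≮p)))

filter-filter : ∀ {A : Set} {P Q : Pred A 0ℓ} (P? : Decidable P) (Q? : Decidable Q) xs →
  filter P? (filter Q? xs) ≡ filter (P? ∩? Q?) xs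
filter-filter P? Q? []       = refl
filter-filter P? Q? (x ∷ xs) with does (Q? x)
... | true with does (P? x)
...   | true  = cong (x ∷_) (filter-filter P? Q? xs)
...   | false = filter-filter P? Q? xs
filter-filter P? Q? (x ∷ xs) | false with does (P? x)
...   | true  = filter-filter P? Q? xs
...   | false = filter-filter P? Q? xs

module _ {A : Set} where

  ⊆-select-interleave : ∀ {xs W : List A} (m : List Bool) → length m ≡ length W → xs ⊆ W →
    ∃₂ λ as bs → Interleaving as bs xs × as ⊆ select m W × bs ⊆ select (map not m) W
  ⊆-select-interleave []          _   []             = [] , [] , [] , [] , []
  ⊆-select-interleave (true ∷ m)  len (w ∷ʳ xs⊆W)
    with as , bs , i , as⊆ , bs⊆ ← ⊆-select-interleave m (suc-injective len) xs⊆W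
    = as , bs , i , w ∷ʳ as⊆ , bs⊆
  ⊆-select-interleave (true ∷ m)  len (refl ∷ xs⊆W)
    with as , bs , i , as⊆ , bs⊆ ← ⊆-select-interleave m (suc-injective len) xs⊆W
    = _ ∷ as , bs , consˡ i , refl ∷ as⊆ , bs⊆
  ⊆-select-interleave (false ∷ m) len (w ∷ʳ xs⊆W)
    with as , bs , i , as⊆ , bs⊆ ← ⊆-select-interleave m (suc-injective len) xs⊆W
    = as , bs , i , as⊆ , w ∷ʳ bs⊆
  ⊆-select-interleave (false ∷ m) len (refl ∷ xs⊆W)
    with as , bs , i , as⊆ , bs⊆ ← ⊆-select-interleave m (suc-injective len) xs⊆W
    = as , _ ∷ bs , consʳ i , as⊆ , refl ∷ bs⊆

  ¬both-orders : ∀ {x y : A} {u} → ¬ x ∷ x ∷ [] ⊆ u → ¬ y ∷ y ∷ [] ⊆ u →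
    x ∷ y ∷ [] ⊆ u → y ∷ x ∷ [] ⊆ u → ⊥
  ¬both-orders ¬xx ¬yy (refl ∷ y⊆) (refl ∷ _)   = ¬xx (refl ∷ y⊆)
  ¬both-orders ¬xx ¬yy (refl ∷ _)  (_ ∷ʳ yx⊆)  = ¬xx (refl ∷ ⊆-trans (_ ∷ʳ refl ∷ []) yx⊆)
  ¬both-orders ¬xx ¬yy (_ ∷ʳ xy⊆)  (refl ∷ _)   = ¬yy (refl ∷ ⊆-trans (_ ∷ʳ refl ∷ []) xy⊆)
  ¬both-orders ¬xx ¬yy (z ∷ʳ xy⊆)  (_ ∷ʳ yx⊆)  =
    ¬both-orders (λ xx⊆ → ¬xx (z ∷ʳ xx⊆)) (λ yy⊆ → ¬yy (z ∷ʳ yy⊆)) xy⊆ yx⊆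

  ¬interleave-yyx : ∀ {x y : A} {u as bs} → ¬ x ∷ x ∷ [] ⊆ u → ¬ y ∷ y ∷ [] ⊆ u →
    Interleaving as bs (y ∷ y ∷ x ∷ []) → x ∷ as ⊆ u → bs ⊆ u → ⊥
  ¬interleave-yyx ¬xx ¬yy (consˡ (consˡ (consˡ []))) xas⊆ _ =
    ¬yy (⊆-trans (_ ∷ʳ refl ∷ refl ∷ _ ∷ʳ []) xas⊆)
  ¬interleave-yyx ¬xx ¬yy (consˡ (consˡ (consʳ []))) xas⊆ _ =
    ¬yy (⊆-trans (_ ∷ʳ refl ∷ refl ∷ []) xas⊆)
  ¬interleave-yyx ¬xx ¬yy (consˡ (consʳ (consˡ []))) xas⊆ _ =
    ¬xx (⊆-trans (refl ∷ _ ∷ʳ refl ∷ []) xas⊆)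
  ¬interleave-yyx ¬xx ¬yy (consˡ (consʳ (consʳ []))) xas⊆ bs⊆ =
    ¬both-orders ¬xx ¬yy xas⊆ bs⊆
  ¬interleave-yyx ¬xx ¬yy (consʳ (consˡ (consˡ []))) xas⊆ _ =
    ¬xx (⊆-trans (refl ∷ _ ∷ʳ refl ∷ []) xas⊆)
  ¬interleave-yyx ¬xx ¬yy (consʳ (consˡ (consʳ []))) xas⊆ bs⊆ =
    ¬both-orders ¬xx ¬yy xas⊆ bs⊆
  ¬interleave-yyx ¬xx ¬yy (consʳ (consʳ (consˡ []))) _ bs⊆ = ¬yy bs⊆
  ¬interleave-yyx ¬xx ¬yy (consʳ (consʳ (consʳ []))) _ bs⊆ =
    ¬yy (⊆-trans (refl ∷ refl ∷ _ ∷ʳ []) bs⊆)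

  ¬interleave-xyyx : ∀ {x y : A} {u as bs} → ¬ x ∷ x ∷ [] ⊆ u → ¬ y ∷ y ∷ [] ⊆ u →
    Interleaving as bs (x ∷ y ∷ y ∷ x ∷ []) → as ⊆ u → bs ⊆ u → ⊥
  ¬interleave-xyyx ¬xx ¬yy (consˡ i) as⊆ bs⊆ = ¬interleave-yyx ¬xx ¬yy i as⊆ bs⊆
  ¬interleave-xyyx ¬xx ¬yy (consʳ i) as⊆ bs⊆ = ¬interleave-yyx ¬xx ¬yy (swap i) bs⊆ as⊆

module _ {k : ℕ} {W : Word k} (occ≡2 : ∀ a → occ a W ≡ 2) where

  occ-square-half : ∀ {m} → length m ≡ length W → select m W ≡ select (map not m) W →
    ∀ a → occ a (select m W) ≡ 1
  occ-square-half {m} len halves≡ a = n+n≡2⇒n≡1 _ (begin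
    occ a u + occ a u                      ≡⟨ cong (λ h → occ a u + occ a h) halves≡ ⟩
    occ a u + occ a (select (map not m) W) ≡⟨ occ-select {a = a} m W len ⟨
    occ a W                                ≡⟨ occ≡2 a ⟩
    2                                      ∎)
    where open ≡-Reasoning; u = select m W

  shuffleSquare⇒¬XYYX : ShuffleSquare W → ¬ HasXYYX W
  shuffleSquare⇒¬XYYX (m , len , halves≡) (x , y , xyyx⊆W)
    with as , bs , i , as⊆ , bs⊆ ← ⊆-select-interleave m len xyyx⊆W
    = ¬interleave-xyyx (no-repeat x) (no-repeat y) i as⊆ (subst (bs ⊆_) (sym halves≡) bs⊆)
    where
    no-repeat : ∀ a → ¬ a ∷ a ∷ [] ⊆ select m W
    no-repeat a aa⊆ = <⇒≱ (s≤s (s≤s z≤n))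
      (subst₂ _≤_ (occ-twice {a = a}) (occ-square-half {m} len halves≡ a) (occ-mono aa⊆))

𝟙[_] : ∀ {P : Set} → Dec P → ℕ
𝟙[ yes _ ] = 1
𝟙[ no _ ]  = 0

𝟙-yes : ∀ {P : Set} (P? : Dec P) → P → 𝟙[ P? ] ≡ 1
𝟙-yes (yes _) _ = refl
𝟙-yes (no ¬p) p = contradiction p ¬p

𝟙-no : ∀ {P : Set} (P? : Dec P) → ¬ P → 𝟙[ P? ] ≡ 0
𝟙-no (yes p) ¬p = contradiction p ¬p
𝟙-no (no _)  _  = refl

𝟙≤1 : ∀ {P : Set} (P? : Dec P) → 𝟙[ P? ] ≤ 1
𝟙≤1 (yes _) = s≤s z≤n
𝟙≤1 (no _)  = z≤n

𝟙-<-suc : ∀ t o → 𝟙[ t <? suc o ] ≡ 𝟙[ t <? o ] + 𝟙[ t ℕ.≟ o ]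
𝟙-<-suc t o with <-cmp t o
... | tri< t<o t≢o _ = trans (𝟙-yes (t <? suc o) (m<n⇒m<1+n t<o))
  (sym (cong₂ _+_ (𝟙-yes (t <? o) t<o) (𝟙-no (t ℕ.≟ o) t≢o)))
... | tri≈ t≮o t≡o _ = trans (𝟙-yes (t <? suc o) (s≤s (≤-reflexive t≡o)))
  (sym (cong₂ _+_ (𝟙-no (t <? o) t≮o) (𝟙-yes (t ℕ.≟ o) t≡o)))
... | tri> t≮o t≢o o<t = trans (𝟙-no (t <? suc o) (<⇒≱ o<t ∘ s≤s⁻¹))
  (sym (cong₂ _+_ (𝟙-no (t <? o) t≮o) (𝟙-no (t ℕ.≟ o) t≢o)))

seen : ℕ → ℕ → ℕ → ℕ
seen c o t = 𝟙[ t <? c ] + 𝟙[ t <? o ]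

seen-open : ∀ c o t → seen c (suc o) t ≡ seen c o t + 𝟙[ t ℕ.≟ o ]
seen-open c o t = trans (cong (𝟙[ t <? c ] +_) (𝟙-<-suc t o)) (sym (+-assoc 𝟙[ t <? c ] _ _))

seen-close : ∀ c o t → seen (suc c) o t ≡ seen c o t + 𝟙[ t ℕ.≟ c ]
seen-close c o t = trans (cong (_+ 𝟙[ t <? o ]) (𝟙-<-suc t c)) (xy∙z≈xz∙y 𝟙[ t <? c ] _ _)

seen-self≤1 : ∀ c o → seen c o c ≤ 1
seen-self≤1 c o =
  subst (_≤ 1) (cong (_+ 𝟙[ c <? o ]) (sym (𝟙-no (c <? c) (<-irrefl refl)))) (𝟙≤1 (c <? o))

-- Ballot numbers

-- Orderings of a further a opening and b closing steps in which the closings never overtake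
-- the openings.
ballot : ℕ → ℕ → ℕ
ballot zero    _       = 1
ballot (suc a) zero    = 0
ballot (suc a) (suc b) with a <? b
... | yes _ = ballot a (suc b) + ballot (suc a) b
... | no _  = ballot a (suc b)

[1+k]*[1+n]C[1+k]≡[1+n]*nCk : ∀ n k → suc k * (suc n C suc k) ≡ suc n * (n C k)
[1+k]*[1+n]C[1+k]≡[1+n]*nCk zero    zero    = refl
[1+k]*[1+n]C[1+k]≡[1+n]*nCk zero    (suc k) rewrite k>n⇒nCk≡0 {1} {suc (suc k)} (s≤s (s≤s z≤n)) =
  *-zeroʳ (suc (suc k))
[1+k]*[1+n]C[1+k]≡[1+n]*nCk (suc n) zero    =
  trans (+-identityʳ _) (trans (nC1≡n (suc (suc n))) (sym (*-identityʳ (suc (suc n)))))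
[1+k]*[1+n]C[1+k]≡[1+n]*nCk (suc n) (suc k) = begin
  suc (suc k) * (suc (suc n) C suc (suc k))
    ≡⟨ cong (suc (suc k) *_) (nCk+nC[k+1]≡[n+1]C[k+1] (suc n) (suc k)) ⟨
  suc (suc k) * (X + Y)
    ≡⟨ *-distribˡ-+ (suc (suc k)) X Y ⟩
  (X + suc k * X) + suc (suc k) * Y
    ≡⟨ cong₂ (λ u v → (X + u) + v) ([1+k]*[1+n]C[1+k]≡[1+n]*nCk n k)
                                   ([1+k]*[1+n]C[1+k]≡[1+n]*nCk n (suc k)) ⟩
  (X + suc n * (n C k)) + suc n * (n C suc k)
    ≡⟨ +-assoc X _ _ ⟩
  X + (suc n * (n C k) + suc n * (n C suc k))
    ≡⟨ cong (X +_) (*-distribˡ-+ (suc n) (n C k) (n C suc k)) ⟨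
  X + suc n * (n C k + n C suc k)
    ≡⟨ cong (λ z → X + suc n * z) (nCk+nC[k+1]≡[n+1]C[k+1] n k) ⟩
  suc (suc n) * X
    ∎
  where
  open ≡-Reasoning
  X = suc n C suc k
  Y = suc n C suc (suc k)

[m+n]Cm≡[m+n]Cn : ∀ m n → (m + n) C m ≡ (m + n) C n
[m+n]Cm≡[m+n]Cn m n = trans (nCk≡nC[n∸k] (m≤m+n m n)) (cong ((m + n) C_) (m+n∸m≡n m n))

-- (a + b) C (a ∸ 1), except that it vanishes for a = 0: by the reflection principle, the
-- lattice paths counted by (a + b) C a that are not ballot paths.
badPaths : ℕ → ℕ → ℕ
badPaths zero    b = 0
badPaths (suc a) b = (suc a + b) C a

badPaths-pascal : ∀ a b → suc (a + suc b) C a ≡ badPaths a (suc b) + (a + suc b) C a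
badPaths-pascal zero    b = refl
badPaths-pascal (suc a) b = sym (nCk+nC[k+1]≡[n+1]C[k+1] (suc a + suc b) a)

ballot+badPaths≡C : ∀ a b → a ≤ b → ballot a b + badPaths a b ≡ (a + b) C a
ballot+badPaths≡C zero    b       _         = refl
ballot+badPaths≡C (suc a) (suc b) (s≤s a≤b) with a <? b
... | yes a<b = begin
  ballot a (suc b) + ballot (suc a) b + suc m C a
    ≡⟨ cong (ballot a (suc b) + ballot (suc a) b +_) (badPaths-pascal a b) ⟩
  ballot a (suc b) + ballot (suc a) b + (badPaths a (suc b) + m C a)
    ≡⟨ interchange (ballot a (suc b)) _ _ _ ⟩
  (ballot a (suc b) + badPaths a (suc b)) + (ballot (suc a) b + m C a)
    ≡⟨ cong₂ _+_ (ballot+badPaths≡C a (suc b) (m≤n⇒m≤1+n a≤b)) ih ⟩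
  m C a + m C suc a
    ≡⟨ nCk+nC[k+1]≡[n+1]C[k+1] m a ⟩
  suc m C suc a
    ∎
  where
  open ≡-Reasoning
  m = a + suc b
  ih : ballot (suc a) b + m C a ≡ m C suc a
  ih = subst (λ z → ballot (suc a) b + z C a ≡ z C suc a) (sym (+-suc a b))
             (ballot+badPaths≡C (suc a) b a<b)
... | no a≮b with refl ← ≤-antisym a≤b (≮⇒≥ a≮b) = begin
  ballot a (suc a) + suc m C a
    ≡⟨ cong (ballot a (suc a) +_) (badPaths-pascal a a) ⟩
  ballot a (suc a) + (badPaths a (suc a) + m C a)
    ≡⟨ +-assoc (ballot a (suc a)) _ _ ⟨
  ballot a (suc a) + badPaths a (suc a) + m C a
    ≡⟨ cong (_+ m C a) (ballot+badPaths≡C a (suc a) (n≤1+n a)) ⟩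
  m C a + m C a
    ≡⟨ cong (m C a +_) ([m+n]Cm≡[m+n]Cn a (suc a)) ⟩
  m C a + m C suc a
    ≡⟨ nCk+nC[k+1]≡[n+1]C[k+1] m a ⟩
  suc m C suc a
    ∎
  where open ≡-Reasoning; m = a + suc a

[2+n]*[2+2n]Cn≡[1+n]*[2+2n]C[1+n] : ∀ n →
  suc (suc n) * ((suc n + suc n) C n) ≡ suc n * ((suc n + suc n) C suc n)
[2+n]*[2+2n]Cn≡[1+n]*[2+2n]C[1+n] n = begin
  suc K * (M C n)       ≡⟨ cong (suc K *_) (subst (λ z → z C n ≡ z C suc K) (+-suc n K)
                                                  ([m+n]Cm≡[m+n]Cn n (suc K))) ⟩
  suc K * (M C suc K)   ≡⟨ [1+k]*[1+n]C[1+k]≡[1+n]*nCk (n + K) K ⟩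
  M * ((n + K) C K)     ≡⟨ cong (M *_) ([m+n]Cm≡[m+n]Cn n K) ⟨
  M * ((n + K) C n)     ≡⟨ [1+k]*[1+n]C[1+k]≡[1+n]*nCk (n + K) n ⟨
  K * (M C K)           ∎
  where
  open ≡-Reasoning
  K = suc n
  M = K + K

ballot≡catalan : ∀ k → ballot k k ≡ catalan k
ballot≡catalan zero    = refl
ballot≡catalan (suc n) = begin
  ballot K K                    ≡⟨ m*n/n≡m (ballot K K) (suc K) ⟨
  (ballot K K * suc K) / suc K  ≡⟨ cong (_/ suc K) ballot*[1+K]≡MCK ⟩
  (M C K) / suc K               ≡⟨ cong (λ z → ((K + z) C K) / suc K) (+-identityʳ K) ⟨
  catalan K                     ∎
  where
  open ≡-Reasoning
  K = suc n
  M = K + K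
  ballot*[1+K]≡MCK : ballot K K * suc K ≡ M C K
  ballot*[1+K]≡MCK = +-cancelʳ-≡ ((M C K) * K) _ _ (begin
    ballot K K * suc K + (M C K) * K     ≡⟨ cong (ballot K K * suc K +_) shift ⟩
    ballot K K * suc K + (M C n) * suc K ≡⟨ *-distribʳ-+ (suc K) (ballot K K) (M C n) ⟨
    (ballot K K + M C n) * suc K         ≡⟨ cong (_* suc K) (ballot+badPaths≡C K K ≤-refl) ⟩
    (M C K) * suc K                      ≡⟨ *-suc (M C K) K ⟩
    M C K + (M C K) * K                  ∎)
    where
    shift : (M C K) * K ≡ (M C n) * suc K
    shift = trans (*-comm (M C K) K)
      (trans (sym ([2+n]*[2+2n]Cn≡[1+n]*[2+2n]C[1+n] n)) (*-comm (suc K) (M C n)))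

-- Words whose first and second occurrences are both in alphabetical order

module OrderedWords (n : ℕ) where

  K : ℕ
  K = suc n

  -- For m ≥ K the junk value is the first letter.
  letter : ℕ → Fin K
  letter m with m <? K
  ... | yes m<K = fromℕ< m<K
  ... | no _    = Fin.zero

  toℕ-letter : ∀ {m} → m < K → toℕ (letter m) ≡ m
  toℕ-letter {m} m<K with m <? K
  ... | yes m<K′ = toℕ-fromℕ< m<K′
  ... | no m≮K   = contradiction m<K m≮K

  letter-toℕ : ∀ (x : Fin K) → letter (toℕ x) ≡ x
  letter-toℕ x = toℕ-injective (toℕ-letter (toℕ<n x))

  letters : ℕ → ℕ → Word K
  letters zero    o = []
  letters (suc r) o = letter o ∷ letters r (suc o)

  lettersFrom : ℕ → Word K
  lettersFrom o = letters (K ∸ o) o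

  lettersFrom-step : ∀ {o} → o < K → lettersFrom o ≡ letter o ∷ lettersFrom (suc o)
  lettersFrom-step o<K rewrite +-∸-assoc 1 o<K = refl

  lettersFrom-K : lettersFrom K ≡ []
  lettersFrom-K rewrite n∸n≡0 K = refl

  letters-tabulate : ∀ r o → letters r o ≡ tabulate {n = r} (λ i → letter (o + toℕ i))
  letters-tabulate zero    o = refl
  letters-tabulate (suc r) o = cong₂ _∷_ (cong letter (sym (+-identityʳ o)))
    (trans (letters-tabulate r (suc o))
           (tabulate-cong (λ i → cong letter (sym (+-suc o (toℕ i))))))

  lettersFrom-0 : lettersFrom 0 ≡ allFin K
  lettersFrom-0 = trans (letters-tabulate K 0) (tabulate-cong letter-toℕ)

  occ-letter : ∀ (x : Fin K) {o} w → o < K → occ x (letter o ∷ w) ≡ 𝟙[ toℕ x ℕ.≟ o ] + occ x w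
  occ-letter x {o} w o<K with letter o ≟ x
  ... | yes refl = sym (cong (_+ occ x w) (𝟙-yes (toℕ x ℕ.≟ o) (toℕ-letter o<K)))
  ... | no o≢x   = sym (cong (_+ occ x w) (𝟙-no (toℕ x ℕ.≟ o) o≢toℕx))
    where
    o≢toℕx : toℕ x ≢ o
    o≢toℕx refl = o≢x (letter-toℕ x)

  atLeast? : ∀ o → Decidable (λ (y : Fin K) → o ≤ toℕ y)
  atLeast? o y = o ≤? toℕ y

  firsts : Word K → Word K
  firsts = deduplicate _≟_

  atLeast-0 : ∀ ys → filter (atLeast? 0) ys ≡ ys
  atLeast-0 ys = filter-all (atLeast? 0) (All.universal (λ _ → z≤n) ys)

  -- firsts (x ∷ w) unfolds to x ∷ remove x (firsts w).
  remove : Fin K → Word K → Word K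
  remove x = filter (¬? ∘ (x ≟_))

  atLeast-remove-below : ∀ {x o} → toℕ x < o → ∀ ys →
    filter (atLeast? o) (remove x ys) ≡ filter (atLeast? o) ys
  atLeast-remove-below {x} x<o ys = trans (filter-filter (atLeast? _) (¬? ∘ (x ≟_)) ys)
    (filter-≐ _ (atLeast? _) (proj₁ , λ o≤y → o≤y , λ { refl → <⇒≱ x<o o≤y }) ys)

  atLeast-remove-least : ∀ {x o} → toℕ x ≡ o → ∀ ys →
    filter (atLeast? o) (remove x ys) ≡ filter (atLeast? (suc o)) ys
  atLeast-remove-least {x} refl ys = trans (filter-filter (atLeast? _) (¬? ∘ (x ≟_)) ys)
    (filter-≐ _ (atLeast? _) ((λ (x≤y , x≢y) → ≤∧≢⇒< x≤y (x≢y ∘ toℕ-injective)) ,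
                              (λ x<y → <⇒≤ x<y , λ { refl → <-irrefl refl x<y })) ys)

  -- Ordered c o w: w finishes a word in which the letters below c have already occurred twice
  -- and those below o at least once, first occurrences and second occurrences each coming in
  -- alphabetical order.
  data Ordered : ℕ → ℕ → Word K → Set where
    done   : Ordered K K []
    opens  : ∀ {c o w} → c ≤ o → o < K → Ordered c (suc o) w → Ordered c o (letter o ∷ w)
    closes : ∀ {c o w} → c < o → Ordered (suc c) o w → Ordered c o (letter c ∷ w)

  Ordered-o≤K : ∀ {c o w} → Ordered c o w → o ≤ K
  Ordered-o≤K done            = ≤-refl
  Ordered-o≤K (opens _ o<K _) = <⇒≤ o<K
  Ordered-o≤K (closes _ w)    = Ordered-o≤K w

  Ordered-occ : ∀ {c o w} → Ordered c o w → ∀ x → seen c o (toℕ x) + occ x w ≡ 2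
  Ordered-occ done x =
    trans (+-identityʳ _) (cong₂ _+_ (𝟙-yes (toℕ x <? K) (toℕ<n x)) (𝟙-yes (toℕ x <? K) (toℕ<n x)))
  Ordered-occ {c} {o} (opens {w = w} _ o<K ow) x = begin
    seen c o t + occ x (letter o ∷ w)              ≡⟨ cong (seen c o t +_) (occ-letter x w o<K) ⟩
    seen c o t + (𝟙[ t ℕ.≟ o ] + occ x w)          ≡⟨ +-assoc (seen c o t) _ _ ⟨
    seen c o t + 𝟙[ t ℕ.≟ o ] + occ x w            ≡⟨ cong (_+ occ x w) (seen-open c o t) ⟨
    seen c (suc o) t + occ x w                     ≡⟨ Ordered-occ ow x ⟩
    2                                              ∎
    where open ≡-Reasoning; t = toℕ x
  Ordered-occ {c} {o} (closes {w = w} c<o ow) x = begin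
    seen c o t + occ x (letter c ∷ w)              ≡⟨ cong (seen c o t +_) (occ-letter x w c<K) ⟩
    seen c o t + (𝟙[ t ℕ.≟ c ] + occ x w)          ≡⟨ +-assoc (seen c o t) _ _ ⟨
    seen c o t + 𝟙[ t ℕ.≟ c ] + occ x w            ≡⟨ cong (_+ occ x w) (seen-close c o t) ⟨
    seen (suc c) o t + occ x w                     ≡⟨ Ordered-occ ow x ⟩
    2                                              ∎
    where open ≡-Reasoning; t = toℕ x; c<K = <-≤-trans c<o (Ordered-o≤K ow)

  Ordered-firsts : ∀ {c o w} → Ordered c o w → filter (atLeast? o) (firsts w) ≡ lettersFrom o
  Ordered-firsts done = sym lettersFrom-K
  Ordered-firsts {o = o} (opens {w = w} _ o<K ow) = begin
    filter (atLeast? o) (letter o ∷ remove (letter o) (firsts w))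
      ≡⟨ filter-accept (atLeast? o) (≤-reflexive (sym (toℕ-letter o<K))) ⟩
    letter o ∷ filter (atLeast? o) (remove (letter o) (firsts w))
      ≡⟨ cong (letter o ∷_) (atLeast-remove-least (toℕ-letter o<K) (firsts w)) ⟩
    letter o ∷ filter (atLeast? (suc o)) (firsts w)
      ≡⟨ cong (letter o ∷_) (Ordered-firsts ow) ⟩
    letter o ∷ lettersFrom (suc o)
      ≡⟨ lettersFrom-step o<K ⟨
    lettersFrom o
      ∎
    where open ≡-Reasoning
  Ordered-firsts {o = o} (closes {c} {w = w} c<o ow) = begin
    filter (atLeast? o) (letter c ∷ remove (letter c) (firsts w))
      ≡⟨ filter-reject (atLeast? o) (<⇒≱ c′<o) ⟩
    filter (atLeast? o) (remove (letter c) (firsts w))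
      ≡⟨ atLeast-remove-below c′<o (firsts w) ⟩
    filter (atLeast? o) (firsts w)
      ≡⟨ Ordered-firsts ow ⟩
    lettersFrom o
      ∎
    where
    open ≡-Reasoning
    c′<o = subst (_< o) (sym (toℕ-letter (<-≤-trans c<o (Ordered-o≤K ow)))) c<o

  Ordered-halves : ∀ {c o w} → Ordered c o w → Σ (List Bool) λ m →
    length m ≡ length w × select m w ≡ lettersFrom o × select (map not m) w ≡ lettersFrom c
  Ordered-halves done = [] , refl , sym lettersFrom-K , sym lettersFrom-K
  Ordered-halves (opens _ o<K ow) with m , len , firsts≡ , seconds≡ ← Ordered-halves ow =
    true ∷ m , cong suc len , trans (cong (_ ∷_) firsts≡) (sym (lettersFrom-step o<K)) , seconds≡
  Ordered-halves (closes c<o ow) with m , len , firsts≡ , seconds≡ ← Ordered-halves ow =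
    false ∷ m , cong suc len , firsts≡ ,
    trans (cong (_ ∷_) seconds≡) (sym (lettersFrom-step (<-≤-trans c<o (Ordered-o≤K ow))))

  Ordered⇒ShuffleSquare : ∀ {c w} → Ordered c c w → ShuffleSquare w
  Ordered⇒ShuffleSquare ow with m , len , firsts≡ , seconds≡ ← Ordered-halves ow =
    m , len , trans firsts≡ (sym seconds≡)

  Ordered⇒Canonical : ∀ {w} → Ordered 0 0 w → Canonical K w
  Ordered⇒Canonical {w} ow = Ordered-occ ow ,
    trans (sym (atLeast-0 (firsts w))) (trans (Ordered-firsts ow) lettersFrom-0)

  -- The state after reading the prefix p of W = p ++ q: the letters below c have been closed and
  -- those below o opened, the letters opened but not closed occur in p in alphabetical order, and
  -- the unopened letters make their first appearances in q in alphabetical order.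
  record Scan (W p q : Word K) (c o : ℕ) : Set where
    field
      W≡p++q       : W ≡ p ++ q
      c≤o          : c ≤ o
      o≤K          : o ≤ K
      occ-prefix   : ∀ x → occ x p ≡ seen c o (toℕ x)
      open-ordered : ∀ y z → c ≤ toℕ y → toℕ y < toℕ z → toℕ z < o → y ∷ z ∷ [] ⊆ p
      firsts-rest  : filter (atLeast? o) (firsts q) ≡ lettersFrom o

  module _ {W : Word K} (canonical : Canonical K W) where

    open Scan

    occ-rest : ∀ {p q c o} → Scan W p q c o → ∀ x → seen c o (toℕ x) + occ x q ≡ 2
    occ-rest {p} {q} {c} {o} s x = begin
      seen c o (toℕ x) + occ x q ≡⟨ cong (_+ occ x q) (occ-prefix s x) ⟨
      occ x p + occ x q          ≡⟨ occ-++ p q ⟨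
      occ x (p ++ q)             ≡⟨ cong (occ x) (W≡p++q s) ⟨
      occ x W                    ≡⟨ proj₁ canonical x ⟩
      2                          ∎
      where open ≡-Reasoning

    scan-start : Scan W [] W 0 0
    scan-start = record
      { W≡p++q       = refl
      ; c≤o          = z≤n
      ; o≤K          = z≤n
      ; occ-prefix   = λ _ → refl
      ; open-ordered = λ _ _ _ _ ()
      ; firsts-rest  = trans (atLeast-0 (firsts W)) (trans (proj₂ canonical) (sym lettersFrom-0))
      }

    scan-end : ∀ {p c o} → Scan W p [] c o → c ≡ K × o ≡ K
    scan-end {c = c} {o} s with c <? K
    ... | yes c<K = contradiction (subst (_≤ 1) seen≡2 (seen-self≤1 c o)) λ { (s≤s ()) }
      where
      seen≡2 : seen c o c ≡ 2
      seen≡2 = trans (sym (+-identityʳ _))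
        (subst (λ t → seen c o t + 0 ≡ 2) (toℕ-letter c<K) (occ-rest s (letter c)))
    ... | no c≮K  = c≡K , ≤-antisym (o≤K s) (subst (_≤ o) c≡K (c≤o s))
      where c≡K = ≤-antisym (≤-trans (c≤o s) (o≤K s)) (≮⇒≥ c≮K)

    module _ {p x q c o} (s : Scan W p (x ∷ q) c o) where

      private
        W≡p+x+q : W ≡ (p ++ [ x ]) ++ q
        W≡p+x+q = trans (W≡p++q s) (sym (++-assoc p [ x ] q))

        occ-p+x : ∀ {m} → m < K → x ≡ letter m →
          ∀ y → occ y (p ++ [ x ]) ≡ seen c o (toℕ y) + 𝟙[ toℕ y ℕ.≟ m ]
        occ-p+x m<K refl y = begin
          occ y (p ++ [ x ])                    ≡⟨ occ-++ p [ x ] ⟩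
          occ y p + occ y [ x ]                 ≡⟨ cong₂ _+_ (occ-prefix s y) (occ-letter y [] m<K) ⟩
          seen c o (toℕ y) + (𝟙[ _ ] + 0)       ≡⟨ cong (seen c o (toℕ y) +_) (+-identityʳ _) ⟩
          seen c o (toℕ y) + 𝟙[ toℕ y ℕ.≟ _ ]   ∎
          where open ≡-Reasoning

      scan-reclose : toℕ x < c → ⊥
      scan-reclose x<c =
        contradiction (trans (sym (cong₂ _+_ seen≡2 (occ-here {a = x} q refl))) (occ-rest s x)) λ ()
        where
        seen≡2 : seen c o (toℕ x) ≡ 2
        seen≡2 = cong₂ _+_ (𝟙-yes (toℕ x <? c) x<c) (𝟙-yes (toℕ x <? o) (<-≤-trans x<c (c≤o s)))

      scan-open : o ≤ toℕ x → o < K × x ≡ letter o × Scan W (p ++ [ x ]) q c (suc o)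
      scan-open o≤x = o<K , x≡o , record
        { W≡p++q       = W≡p+x+q
        ; c≤o          = ≤-trans (c≤o s) (n≤1+n o)
        ; o≤K          = o<K
        ; occ-prefix   = λ y → trans (occ-p+x o<K x≡o y) (sym (seen-open c o (toℕ y)))
        ; open-ordered = open-ordered′
        ; firsts-rest  = trans (sym (atLeast-remove-least toℕx≡o (firsts q)))
                               (proj₂ (∷-injective heads≡))
        }
        where
        o<K = ≤-<-trans o≤x (toℕ<n x)
        heads≡ : x ∷ filter (atLeast? o) (remove x (firsts q)) ≡ letter o ∷ lettersFrom (suc o)
        heads≡ = trans (sym (filter-accept (atLeast? o) o≤x))
                       (trans (firsts-rest s) (lettersFrom-step o<K))
        x≡o = proj₁ (∷-injective heads≡)
        toℕx≡o = trans (cong toℕ x≡o) (toℕ-letter o<K)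
        open-ordered′ : ∀ y z → c ≤ toℕ y → toℕ y < toℕ z → toℕ z < suc o → y ∷ z ∷ [] ⊆ p ++ [ x ]
        open-ordered′ y z c≤y y<z z≤o with toℕ z <? o
        ... | yes z<o = ++⁺ʳ [ x ] (open-ordered s y z c≤y y<z z<o)
        ... | no z≮o  = ++⁺ (from∈ (occ>0⇒∈ y-opened)) (z≡x ∷ [])
          where
          toℕz≡o = ≤-antisym (s≤s⁻¹ z≤o) (≮⇒≥ z≮o)
          z≡x = toℕ-injective (trans toℕz≡o (sym toℕx≡o))
          y-opened : 0 < occ y p
          y-opened = subst (0 <_) (sym (trans (occ-prefix s y) (cong (𝟙[ toℕ y <? c ] +_) y<o)))
                           (m≤n+m 1 _)
            where y<o = 𝟙-yes (toℕ y <? o) (subst (toℕ y <_) toℕz≡o y<z)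

      scan-close : toℕ x ≡ c → c < o → x ≡ letter c × Scan W (p ++ [ x ]) q (suc c) o
      scan-close refl x<o = x≡c , record
        { W≡p++q       = W≡p+x+q
        ; c≤o          = x<o
        ; o≤K          = o≤K s
        ; occ-prefix   = λ y → trans (occ-p+x (toℕ<n x) x≡c y) (sym (seen-close c o (toℕ y)))
        ; open-ordered = λ y z c<y y<z z<o → ++⁺ʳ [ x ] (open-ordered s y z (<⇒≤ c<y) y<z z<o)
        ; firsts-rest  = begin
            filter (atLeast? o) (firsts q)            ≡⟨ atLeast-remove-below x<o (firsts q) ⟨
            filter (atLeast? o) (remove x (firsts q)) ≡⟨ filter-reject (atLeast? o) (<⇒≱ x<o) ⟨
            filter (atLeast? o) (firsts (x ∷ q))      ≡⟨ firsts-rest s ⟩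
            lettersFrom o                             ∎
        }
        where
        open ≡-Reasoning
        x≡c = sym (letter-toℕ x)

      scan-nested : c < toℕ x → toℕ x < o → HasXYYX W
      scan-nested c<x x<o = letter c , x , subst (letter c ∷ x ∷ x ∷ letter c ∷ [] ⊆_) (sym (W≡p++q s))
        (++⁺ c-before-x (refl ∷ from∈ (occ>0⇒∈ (≤-reflexive (sym c-once-in-q)))))
        where
        toℕc≡c = toℕ-letter (<-trans c<x (toℕ<n x))
        c-before-x : letter c ∷ x ∷ [] ⊆ p
        c-before-x = open-ordered s (letter c) x (≤-reflexive (sym toℕc≡c))
                                  (subst (_< toℕ x) (sym toℕc≡c) c<x) x<o
        x≢c : x ≢ letter c
        x≢c x≡c = <-irrefl (trans (sym toℕc≡c) (cong toℕ (sym x≡c))) c<x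
        seen≡1 : seen c o (toℕ (letter c)) ≡ 1
        seen≡1 = trans (cong (seen c o) toℕc≡c)
          (cong₂ _+_ (𝟙-no (c <? c) (<-irrefl refl)) (𝟙-yes (c <? o) (<-trans c<x x<o)))
        c-once-in-q : occ (letter c) q ≡ 1
        c-once-in-q = suc-injective (begin
          1 + occ (letter c) q                          ≡⟨ cong₂ _+_ seen≡1 (occ-there q x≢c) ⟨
          seen c o (toℕ (letter c)) + occ _ (x ∷ q)     ≡⟨ occ-rest s (letter c) ⟩
          2                                             ∎)
          where open ≡-Reasoning

    scan : ¬ HasXYYX W → ∀ {p q c o} → Scan W p q c o → Ordered c o q
    scan ¬xyyx {q = []} s with refl , refl ← scan-end s = done
    scan ¬xyyx {q = x ∷ q} {c} {o} s with toℕ x <? c | o ≤? toℕ x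
    ... | yes x<c | _ = ⊥-elim (scan-reclose s x<c)
    ... | no _    | yes o≤x with o<K , refl , s′ ← scan-open s o≤x = opens (c≤o s) o<K (scan ¬xyyx s′)
    ... | no x≮c  | no x≱o with toℕ x ℕ.≟ c
    ...   | yes refl with x≡c , s′ ← scan-close s refl (≰⇒> x≱o) =
      subst (λ y → Ordered (toℕ x) o (y ∷ q)) (sym x≡c) (closes (≰⇒> x≱o) (scan ¬xyyx s′))
    ...   | no x≢c  = ⊥-elim (¬xyyx (scan-nested s (≤∧≢⇒< (≮⇒≥ x≮c) (x≢c ∘ sym)) (≰⇒> x≱o)))

  canonical-¬XYYX⇒Ordered : ∀ {W} → Canonical K W → ¬ HasXYYX W → Ordered 0 0 W
  canonical-¬XYYX⇒Ordered canonical ¬xyyx = scan canonical ¬xyyx (scan-start canonical)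

  -- The Ordered c o words that open a further a letters and close a further b letters.
  orderedWords : ℕ → ℕ → ℕ → ℕ → List (Word K)
  orderedWords c o zero    zero    = [ [] ]
  orderedWords c o (suc a) zero    = []
  orderedWords c o zero    (suc b) = map (letter c ∷_) (orderedWords (suc c) o zero b)
  orderedWords c o (suc a) (suc b) with a <? b
  ... | yes _ = map (letter o ∷_) (orderedWords c (suc o) a (suc b))
             ++ map (letter c ∷_) (orderedWords (suc c) o (suc a) b)
  ... | no _  = map (letter o ∷_) (orderedWords c (suc o) a (suc b))

  length-orderedWords : ∀ c o a b → length (orderedWords c o a b) ≡ ballot a b
  length-orderedWords c o zero    zero    = refl
  length-orderedWords c o (suc a) zero    = refl
  length-orderedWords c o zero    (suc b) =
    trans (length-map _ (orderedWords (suc c) o zero b)) (length-orderedWords (suc c) o zero b)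
  length-orderedWords c o (suc a) (suc b) with a <? b
  ... | yes _ = trans (length-++ (map (letter o ∷_) opening))
      (cong₂ _+_ (trans (length-map _ opening) (length-orderedWords c (suc o) a (suc b)))
                 (trans (length-map _ closing) (length-orderedWords (suc c) o (suc a) b)))
    where opening = orderedWords c (suc o) a (suc b); closing = orderedWords (suc c) o (suc a) b
  ... | no _  = trans (length-map _ opening) (length-orderedWords c (suc o) a (suc b))
    where opening = orderedWords c (suc o) a (suc b)

  private
    m+1+r≡K⇒m<K : ∀ {m r} → m + suc r ≡ K → m < K
    m+1+r≡K⇒m<K {m} eq = subst (m <_) eq (m<m+n m (s≤s z≤n))

    m+1+r≡K⇒1+m+r≡K : ∀ {m r} → m + suc r ≡ K → suc m + r ≡ K
    m+1+r≡K⇒1+m+r≡K {m} {r} eq = trans (sym (+-suc m r)) eq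

    m+0≡K⇒m≡K : ∀ {m} → m + 0 ≡ K → m ≡ K
    m+0≡K⇒m≡K {m} = trans (sym (+-identityʳ m))

  orderedWords-sound : ∀ {c o} a b {w} → o + a ≡ K → c + b ≡ K → c ≤ o →
    w ∈ orderedWords c o a b → Ordered c o w

  orderedWords-sound-opening : ∀ {c o} a b {w} → o + suc a ≡ K → c + suc b ≡ K → c ≤ o →
    w ∈ map (letter o ∷_) (orderedWords c (suc o) a (suc b)) → Ordered c o w
  orderedWords-sound-opening a b o+a≡K c+b≡K c≤o w∈ with _ , w′∈ , refl ← ∈-map⁻ _ w∈ =
    opens c≤o (m+1+r≡K⇒m<K o+a≡K)
      (orderedWords-sound a (suc b) (m+1+r≡K⇒1+m+r≡K o+a≡K) c+b≡K (m≤n⇒m≤1+n c≤o) w′∈)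

  orderedWords-sound zero zero o+a≡K c+b≡K _ (here refl) =
    subst₂ (λ c o → Ordered c o []) (sym (m+0≡K⇒m≡K c+b≡K)) (sym (m+0≡K⇒m≡K o+a≡K)) done
  orderedWords-sound zero (suc b) o+a≡K c+b≡K _ w∈ with _ , w′∈ , refl ← ∈-map⁻ _ w∈ =
    closes c<o (orderedWords-sound zero b o+a≡K (m+1+r≡K⇒1+m+r≡K c+b≡K) c<o w′∈)
    where c<o = m+n≡o+p∧n<p⇒o<m (trans o+a≡K (sym c+b≡K)) (s≤s z≤n)
  orderedWords-sound {c} {o} (suc a) (suc b) o+a≡K c+b≡K c≤o w∈ with a <? b
  ... | no _ = orderedWords-sound-opening a b o+a≡K c+b≡K c≤o w∈
  ... | yes a<b with ∈-++⁻ (map (letter o ∷_) (orderedWords c (suc o) a (suc b))) w∈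
  ...   | inj₁ w∈₁ = orderedWords-sound-opening a b o+a≡K c+b≡K c≤o w∈₁
  ...   | inj₂ w∈₂ with _ , w′∈ , refl ← ∈-map⁻ _ w∈₂ =
    closes c<o (orderedWords-sound (suc a) b o+a≡K (m+1+r≡K⇒1+m+r≡K c+b≡K) c<o w′∈)
    where c<o = m+n≡o+p∧n<p⇒o<m (trans o+a≡K (sym c+b≡K)) (s≤s a<b)

  orderedWords-complete : ∀ {c o w} → Ordered c o w → ∀ a b → o + a ≡ K → c + b ≡ K →
    w ∈ orderedWords c o a b
  orderedWords-complete done zero    zero    _     _     = here refl
  orderedWords-complete done (suc a) _       o+a≡K _     = contradiction o+a≡K (m+1+n≢m K)
  orderedWords-complete done zero    (suc b) _     c+b≡K = contradiction c+b≡K (m+1+n≢m K)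
  orderedWords-complete (opens _ o<K _) zero _ o+a≡K _ = contradiction (m+0≡K⇒m≡K o+a≡K) (<⇒≢ o<K)
  orderedWords-complete (opens c≤o o<K _) (suc a) zero _ c+b≡K =
    contradiction (m+0≡K⇒m≡K c+b≡K) (<⇒≢ (≤-<-trans c≤o o<K))
  orderedWords-complete {c} {o} (opens _ _ ow) (suc a) (suc b) o+a≡K c+b≡K with a <? b
  ... | yes _ = ∈-++⁺ˡ (∈-map⁺ _ (orderedWords-complete ow a (suc b) (m+1+r≡K⇒1+m+r≡K o+a≡K) c+b≡K))
  ... | no _  = ∈-map⁺ _ (orderedWords-complete ow a (suc b) (m+1+r≡K⇒1+m+r≡K o+a≡K) c+b≡K)
  orderedWords-complete (closes c<o ow) a zero _ c+b≡K =
    contradiction (m+0≡K⇒m≡K c+b≡K) (<⇒≢ (<-≤-trans c<o (Ordered-o≤K ow)))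
  orderedWords-complete (closes _ ow) zero (suc b) o+a≡K c+b≡K =
    ∈-map⁺ _ (orderedWords-complete ow zero b o+a≡K (m+1+r≡K⇒1+m+r≡K c+b≡K))
  orderedWords-complete {c} {o} (closes c<o ow) (suc a) (suc b) o+a≡K c+b≡K with a <? b
  ... | yes _ = ∈-++⁺ʳ (map (letter o ∷_) (orderedWords c (suc o) a (suc b)))
                  (∈-map⁺ _ (orderedWords-complete ow (suc a) b o+a≡K (m+1+r≡K⇒1+m+r≡K c+b≡K)))
  ... | no a≮b = contradiction (s≤s⁻¹ (m+n≡o+p∧o<m⇒n<p (trans o+a≡K (sym c+b≡K)) c<o)) a≮b

  orderedWords-unique : ∀ c o a b → o + a ≡ K → c + b ≡ K → Unique (orderedWords c o a b)
  orderedWords-unique c o zero    zero    _     _     = All.[] ∷ []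
  orderedWords-unique c o (suc a) zero    _     _     = []
  orderedWords-unique c o zero    (suc b) o+a≡K c+b≡K =
    Unique.map⁺ ∷-injectiveʳ (orderedWords-unique (suc c) o zero b o+a≡K (m+1+r≡K⇒1+m+r≡K c+b≡K))
  orderedWords-unique c o (suc a) (suc b) o+a≡K c+b≡K with a <? b
  ... | no _ = Unique.map⁺ ∷-injectiveʳ
                 (orderedWords-unique c (suc o) a (suc b) (m+1+r≡K⇒1+m+r≡K o+a≡K) c+b≡K)
  ... | yes a<b = Unique.++⁺
    (Unique.map⁺ ∷-injectiveʳ (orderedWords-unique c (suc o) a (suc b) (m+1+r≡K⇒1+m+r≡K o+a≡K) c+b≡K))
    (Unique.map⁺ ∷-injectiveʳ (orderedWords-unique (suc c) o (suc a) b o+a≡K (m+1+r≡K⇒1+m+r≡K c+b≡K)))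
    first-letters-differ
    where
    first-letters-differ : ∀ {v} → ¬ (v ∈ map (letter o ∷_) (orderedWords c (suc o) a (suc b))
                                      × v ∈ map (letter c ∷_) (orderedWords (suc c) o (suc a) b))
    first-letters-differ (v∈₁ , v∈₂) with _ , _ , refl ← ∈-map⁻ _ v∈₁ | _ , _ , v≡ ← ∈-map⁻ _ v∈₂ =
      <⇒≢ (m+n≡o+p∧n<p⇒o<m (trans o+a≡K (sym c+b≡K)) (s≤s a<b))
        (trans (sym (toℕ-letter (m+1+r≡K⇒m<K c+b≡K)))
          (trans (cong toℕ (sym (∷-injectiveˡ v≡))) (toℕ-letter (m+1+r≡K⇒m<K o+a≡K))))

  canonical-shuffleSquare⇔¬XYYX : ∀ {W} → Canonical K W → ShuffleSquare W ⇔ (¬ HasXYYX W)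
  canonical-shuffleSquare⇔¬XYYX canonical = mk⇔ (shuffleSquare⇒¬XYYX (proj₁ canonical))
    (Ordered⇒ShuffleSquare ∘ canonical-¬XYYX⇒Ordered canonical)

  canonical-shuffleSquare⇒Ordered : ∀ {W} → Canonical K W → ShuffleSquare W → Ordered 0 0 W
  canonical-shuffleSquare⇒Ordered canonical =
    canonical-¬XYYX⇒Ordered canonical ∘ shuffleSquare⇒¬XYYX (proj₁ canonical)

proposition8 : (k : ℕ) → k ≥ 1 →
    ((W : Word k) → Canonical k W → (ShuffleSquare W ⇔ (¬ HasXYYX W)))
    × Σ (List (Word k)) (λ L →
        Unique L
        × All (λ W → Canonical k W × ShuffleSquare W) L
        × ((W : Word k) → Canonical k W → ShuffleSquare W → W ∈ L)
        × length L ≡ catalan k)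
proposition8 (suc n) _ =
    (λ _ → canonical-shuffleSquare⇔¬XYYX)
  , orderedWords 0 0 K K
  , orderedWords-unique 0 0 K K refl refl
  , All.tabulate (λ w∈ → let ow = orderedWords-sound K K refl refl z≤n w∈ in
                          Ordered⇒Canonical ow , Ordered⇒ShuffleSquare ow)
  , (λ _ canonical square →
       orderedWords-complete (canonical-shuffleSquare⇒Ordered canonical square) K K refl refl)
  , trans (length-orderedWords 0 0 K K) (ballot≡catalan K)
  where open OrderedWords n
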